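{- For every $d\ge1$, $\mathbf k\in\mathbb N_{>0}^d$, integer $k\ge2$ and $2\le p<\infty$, $$\gamma_{\mathbf k,k-1}(p)\le\gamma_{\mathbf k,k}\Big(\frac{p\,\mathcal K_{\mathbf k,k}}{\mathcal K_{\mathbf k,k-1}}\Big).$$
   Context: $\mathbb N=\{0,1,\dots\}$, $|\mathbf a|=\sum a_i$. For $d\ge0$, $\mathbf k=(k_1,\dots,k_d)\in\mathbb N_{>0}^d$ and $k\ge0$: $\mathcal K_{\mathbf k,k}:=\sum\{|\mathbf a|:\mathbf a\in\mathbb N^d,\ a_i\le k_i\ \forall i,\ 1\le|\mathbf a|\le k\}$, $\mathbf k_{(j)}:=(k_1,\dots,k_{j-1},k_{j+1},\dots,k_d)$. For $2\le p<\infty$: $\gamma_{\mathbf k,k}(p)=0$ if $d=0$ or $k=0$, and otherwise $\gamma_{\mathbf k,k}(p)=\max\big(\frac d2,\ d-\frac{\mathcal K_{\mathbf k,k}}p,\ \max_{1\le j\le d}\gamma_{\mathbf k_{(j)},k}(p)+\frac1p\big)$.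
   Formalization: The parameter p ranges only over the rationals with 2 ≤ p. -}

module Defs where

open import Data.Nat as ℕ using (ℕ; zero; suc; _≤ᵇ_)
open import Data.Bool using (_∧_)
open import Data.Integer using (+_)
open import Data.Rational using (ℚ; 0ℚ; _/_; _+_; _-_; _*_; _⊔_; 1/_; ≢-nonZero)
open import Data.Rational.Properties using (_≟_)
open import Data.Fin using (Fin)
open import Data.Vec using (Vec; []; _∷_; removeAt)
open import Data.List using (List; [_]; map; concatMap; filterᵇ; upTo; allFin; foldr) renaming ([] to nil; _∷_ to _∷ₗ_)
open import Data.Nat.ListAction using (sum)
open import Relation.Nullary using (yes; no)

ℕ→ℚ : ℕ → ℚ
ℕ→ℚ n = + n / 1

-- total inverse on ℚ (inv 0 = 0); only ever applied to nonzero arguments below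
inv : ℚ → ℚ
inv p with p ≟ 0ℚ
... | yes _ = 0ℚ
... | no p≢0 = 1/_ p {{≢-nonZero p≢0}}

box : ∀ {d} → Vec ℕ d → List (List ℕ)
box [] = [ nil ]
box (ki ∷ ks) = concatMap (λ a → map (a ∷ₗ_) (box ks)) (upTo (suc ki))

𝒦 : ∀ {d} → Vec ℕ d → ℕ → ℕ
𝒦 ks k = sum (filterᵇ (λ s → (1 ≤ᵇ s) ∧ (s ≤ᵇ k)) (map sum (box ks)))

γ : (d : ℕ) → Vec ℕ d → ℕ → ℚ → ℚ
γ zero _ _ _ = 0ℚ
γ (suc d) ks zero p = 0ℚ
γ (suc d) ks (suc k') p =
  foldr _⊔_
        ((ℕ→ℚ (suc d) * (+ 1 / 2)) ⊔ (ℕ→ℚ (suc d) - ℕ→ℚ (𝒦 ks (suc k')) * inv p))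
        (map (λ j → γ d (removeAt ks j) (suc k') p + inv p) (allFin (suc d)))

{-# OPTIONS --safe #-}
module Submission where

-- Unfolding its recursion, γ_{𝐤,k−1}(p) is the largest of the numbers max(|T|/2, |T| − 𝒦_{T,k−1}/p) + m/p,
-- T ranging over the vectors obtained from 𝐤 by deleting m entries (and m/p itself once T is empty).
-- Each of them is bounded by a term of the unfolding of γ_{𝐤,k}(p′), p′ = p 𝒦_{𝐤,k}/𝒦_{𝐤,k−1}:
-- |T|/2 + m/p by d/2 since p ≥ 2, and the deficit term either by |T| − 𝒦_{T,k}/p′ + m/p′ or by one of
-- d/2, d − 𝒦_{𝐤,k}/p′. Which bound applies is decided by a linear inequality between the moments
-- 𝒦_{·,l} = Σ_{1≤s≤l} s·cₛ of the coefficient sequences c of P_T = ∏_{i∈T} (1 + z + ⋯ + z^{kᵢ}) and of P_𝐤.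
-- That inequality holds because c^𝐤ₛ / c^Tₛ is nondecreasing in s: P_𝐤 is a sum of shifts of P_T,
-- and P_T is log-concave, being a product of log-concave factors.

module Coefficients where

  open import Data.Bool using (Bool; true; false; if_then_else_; _∧_)
  open import Data.Fin using (Fin; zero; suc)
  open import Data.List using (List; []; _∷_; _++_; map; concatMap; filterᵇ; applyUpTo)
  open import Data.List.Properties using (map-++)
  open import Data.Nat
    using (ℕ; zero; suc; NonZero; ≢-nonZero; _+_; _*_; _∸_; _≤_; _<_; z≤n; s≤s; z<s; s<s; _≤?_; _≤ᵇ_; _<ᵇ_)
  open import Data.Nat.ListAction using (sum)
  open import Data.Nat.Properties
  open import Algebra.Properties.CommutativeSemigroup +-commutativeSemigroup using (interchange)
  open import Data.Nat.Tactic.RingSolver using (solve-∀)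
  open import Data.Sum using (_⊎_; inj₁; inj₂)
  open import Data.Vec using (Vec; lookup; removeAt) renaming ([] to []ᵥ; _∷_ to _∷ᵥ_)
  open import Function using (_∘_)
  open import Relation.Binary.PropositionalEquality
  open import Relation.Nullary using (yes; no)
  open import Defs using (box; 𝒦)

  Σ< : ℕ → (ℕ → ℕ) → ℕ
  Σ< zero    f = 0
  Σ< (suc n) f = f 0 + Σ< n (f ∘ suc)

  Σ<-cong : ∀ n {f g} → f ≗ g → Σ< n f ≡ Σ< n g
  Σ<-cong zero    f≗g = refl
  Σ<-cong (suc n) f≗g = cong₂ _+_ (f≗g 0) (Σ<-cong n (f≗g ∘ suc))

  Σ<-mono-≤ : ∀ n {f g} → (∀ i → i < n → f i ≤ g i) → Σ< n f ≤ Σ< n g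
  Σ<-mono-≤ zero    f≤g = z≤n
  Σ<-mono-≤ (suc n) f≤g = +-mono-≤ (f≤g 0 z<s) (Σ<-mono-≤ n (λ i i<n → f≤g (suc i) (s<s i<n)))

  Σ<-zero : ∀ n → Σ< n (λ _ → 0) ≡ 0
  Σ<-zero zero    = refl
  Σ<-zero (suc n) = Σ<-zero n

  Σ<-distrib-+ : ∀ n f g → Σ< n (λ i → f i + g i) ≡ Σ< n f + Σ< n g
  Σ<-distrib-+ zero    f g = refl
  Σ<-distrib-+ (suc n) f g =
    trans (cong (f 0 + g 0 +_) (Σ<-distrib-+ n (f ∘ suc) (g ∘ suc))) (interchange (f 0) (g 0) _ _)

  *-distribˡ-Σ< : ∀ n c f → c * Σ< n f ≡ Σ< n (λ i → c * f i)
  *-distribˡ-Σ< zero    c f = *-zeroʳ c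
  *-distribˡ-Σ< (suc n) c f = trans (*-distribˡ-+ c (f 0) _) (cong (c * f 0 +_) (*-distribˡ-Σ< n c (f ∘ suc)))

  *-distribʳ-Σ< : ∀ n c f → Σ< n f * c ≡ Σ< n (λ i → f i * c)
  *-distribʳ-Σ< n c f = trans (*-comm _ c) (trans (*-distribˡ-Σ< n c f) (Σ<-cong n (λ i → *-comm c (f i))))

  Σ<-split : ∀ m n f → Σ< (m + n) f ≡ Σ< m f + Σ< n (λ i → f (m + i))
  Σ<-split zero    n f = refl
  Σ<-split (suc m) n f = trans (cong (f 0 +_) (Σ<-split m n (f ∘ suc))) (sym (+-assoc (f 0) _ _))

  Σ<-last : ∀ n f → Σ< (suc n) f ≡ Σ< n f + f n
  Σ<-last n f = begin
    Σ< (suc n) f               ≡⟨ cong (λ m → Σ< m f) (+-comm 1 n) ⟩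
    Σ< (n + 1) f               ≡⟨ Σ<-split n 1 f ⟩
    Σ< n f + (f (n + 0) + 0)   ≡⟨ cong (λ z → Σ< n f + z) (trans (+-identityʳ _) (cong f (+-identityʳ n))) ⟩
    Σ< n f + f n               ∎
    where open ≡-Reasoning

  Σ<-swap : ∀ m n (F : ℕ → ℕ → ℕ) → Σ< m (λ i → Σ< n (F i)) ≡ Σ< n (λ j → Σ< m (λ i → F i j))
  Σ<-swap zero    n F = sym (Σ<-zero n)
  Σ<-swap (suc m) n F =
    trans (cong (Σ< n (F 0) +_) (Σ<-swap m n (F ∘ suc))) (sym (Σ<-distrib-+ n (F 0) (λ j → Σ< m (λ i → F (suc i) j))))

  Σ<-product : ∀ m n f g → Σ< m f * Σ< n g ≡ Σ< m (λ i → Σ< n (λ j → f i * g j))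
  Σ<-product m n f g = trans (*-distribʳ-Σ< m _ f) (Σ<-cong m (λ i → *-distribˡ-Σ< n (f i) g))

  -- shift a f and window c f are the coefficient sequences of z^a F(z) and (1 + z + ⋯ + z^c) F(z).
  shift : ℕ → (ℕ → ℕ) → ℕ → ℕ
  shift zero    f s       = f s
  shift (suc a) f zero    = 0
  shift (suc a) f (suc s) = shift a f s

  window : ℕ → (ℕ → ℕ) → ℕ → ℕ
  window c f s = Σ< (suc c) (λ i → shift i f s)

  shift-cong : ∀ a {f g} → f ≗ g → shift a f ≗ shift a g
  shift-cong zero    f≗g s       = f≗g s
  shift-cong (suc a) f≗g zero    = refl
  shift-cong (suc a) f≗g (suc s) = shift-cong a f≗g s

  shift-zero : ∀ a → shift a (λ _ → 0) ≗ λ _ → 0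
  shift-zero zero    s       = refl
  shift-zero (suc a) zero    = refl
  shift-zero (suc a) (suc s) = shift-zero a s

  shift-below : ∀ {a s} f → s < a → shift a f s ≡ 0
  shift-below {suc a} {zero}  f _         = refl
  shift-below {suc a} {suc s} f (s<s s<a) = shift-below f s<a

  shift-above : ∀ {a s} f → a ≤ s → shift a f s ≡ f (s ∸ a)
  shift-above {zero}          f _         = refl
  shift-above {suc a} {suc s} f (s≤s a≤s) = shift-above f a≤s

  shift-shift : ∀ a b f → shift a (shift b f) ≗ shift (a + b) f
  shift-shift zero    b f s       = refl
  shift-shift (suc a) b f zero    = refl
  shift-shift (suc a) b f (suc s) = shift-shift a b f s

  shift-distrib-+ : ∀ a f g → shift a (λ s → f s + g s) ≗ λ s → shift a f s + shift a g s
  shift-distrib-+ zero    f g s       = refl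
  shift-distrib-+ (suc a) f g zero    = refl
  shift-distrib-+ (suc a) f g (suc s) = shift-distrib-+ a f g s

  shift-Σ< : ∀ a n (F : ℕ → ℕ → ℕ) → shift a (λ s → Σ< n (λ i → F i s)) ≗ λ s → Σ< n (λ i → shift a (F i) s)
  shift-Σ< zero    n       F s       = refl
  shift-Σ< (suc a) n       F zero    = sym (Σ<-zero n)
  shift-Σ< (suc a) n       F (suc s) = shift-Σ< a n F s

  window-cong : ∀ c {f g} → f ≗ g → window c f ≗ window c g
  window-cong c f≗g s = Σ<-cong (suc c) (λ i → shift-cong i f≗g s)

  shift-window : ∀ a c f → shift a (window c f) ≗ λ s → Σ< (suc c) (λ i → shift (a + i) f s)
  shift-window a c f s =
    trans (shift-Σ< a (suc c) (λ i → shift i f) s) (Σ<-cong (suc c) (λ i → shift-shift a i f s))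

  window-comm : ∀ c c′ f → window c (window c′ f) ≗ window c′ (window c f)
  window-comm c c′ f s = begin
    Σ< (suc c) (λ i → shift i (window c′ f) s)
      ≡⟨ Σ<-cong (suc c) (λ i → shift-window i c′ f s) ⟩
    Σ< (suc c) (λ i → Σ< (suc c′) (λ j → shift (i + j) f s))
      ≡⟨ Σ<-swap (suc c) (suc c′) (λ i j → shift (i + j) f s) ⟩
    Σ< (suc c′) (λ j → Σ< (suc c) (λ i → shift (i + j) f s))
      ≡⟨ Σ<-cong (suc c′) (λ j → Σ<-cong (suc c) (λ i → cong (λ a → shift a f s) (+-comm i j))) ⟩
    Σ< (suc c′) (λ j → Σ< (suc c) (λ i → shift (j + i) f s))
      ≡⟨ Σ<-cong (suc c′) (λ j → shift-window j c f s) ⟨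
    Σ< (suc c′) (λ j → shift j (window c f) s) ∎
    where open ≡-Reasoning

  -- Unlike f(n)² ≥ f(n − 1) f(n + 1), this form of log-concavity also excludes internal zeros.
  LogConcave : (ℕ → ℕ) → Set
  LogConcave f = ∀ {a b} h → a ≤ b → f a * f (b + h) ≤ f b * f (a + h)

  shift-pair-≤ : ∀ {f} → LogConcave f → ∀ {a b i j h} → a ≤ b → j ≤ i + h →
                 shift i f a * shift j f (b + h) ≤ shift i f b * shift j f (a + h)
  shift-pair-≤ {f} lc {a} {b} {i} {j} {h} a≤b j≤i+h with i ≤? a
  ... | no i≰a rewrite shift-below f (≰⇒> i≰a) = z≤n
  ... | yes i≤a = begin
    shift i f a * shift j f (b + h)              ≡⟨ cong₂ _*_ (shift-above f i≤a) (shift-above f (j≤+h i≤b)) ⟩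
    f (a ∸ i) * f (b + h ∸ j)                    ≡⟨ cong (λ n → f (a ∸ i) * f n) (rebase i≤b) ⟩
    f (a ∸ i) * f ((b ∸ i) + (i + h ∸ j))        ≤⟨ lc (i + h ∸ j) (∸-monoˡ-≤ i a≤b) ⟩
    f (b ∸ i) * f ((a ∸ i) + (i + h ∸ j))        ≡⟨ cong (λ n → f (b ∸ i) * f n) (rebase i≤a) ⟨
    f (b ∸ i) * f (a + h ∸ j)                    ≡⟨ cong₂ _*_ (shift-above f i≤b) (shift-above f (j≤+h i≤a)) ⟨
    shift i f b * shift j f (a + h)              ∎
    where
    open ≤-Reasoning
    i≤b : i ≤ b
    i≤b = ≤-trans i≤a a≤b
    j≤+h : ∀ {n} → i ≤ n → j ≤ n + h
    j≤+h i≤n = ≤-trans j≤i+h (+-monoˡ-≤ h i≤n)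
    rebase : ∀ {n} → i ≤ n → n + h ∸ j ≡ (n ∸ i) + (i + h ∸ j)
    rebase {n} i≤n = begin-equality
      n + h ∸ j                ≡⟨ cong (λ m → m + h ∸ j) (m∸n+n≡m i≤n) ⟨
      (n ∸ i) + i + h ∸ j      ≡⟨ cong (_∸ j) (+-assoc (n ∸ i) i h) ⟩
      (n ∸ i) + (i + h) ∸ j    ≡⟨ +-∸-assoc (n ∸ i) j≤i+h ⟩
      (n ∸ i) + (i + h ∸ j)    ∎

  Σ<-square-split : ∀ q h (X : ℕ → ℕ → ℕ) →
    Σ< (q + h) (λ i → Σ< (q + h) (X i))
      ≡ (Σ< q (λ i → Σ< h (X i)) + Σ< q (λ i → Σ< q (λ j → X i (h + j))))
        + Σ< h (λ i → Σ< (q + h) (X (q + i)))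
  Σ<-square-split q h X = trans (Σ<-split q h _) (cong (_+ Σ< h (λ i → Σ< (q + h) (X (q + i)))) rows)
    where
    rows : Σ< q (λ i → Σ< (q + h) (X i)) ≡ Σ< q (λ i → Σ< h (X i)) + Σ< q (λ i → Σ< q (λ j → X i (h + j)))
    rows = trans (Σ<-cong q (λ i → trans (cong (λ n → Σ< n (X i)) (+-comm q h)) (Σ<-split h q (X i))))
                 (Σ<-distrib-+ q (λ i → Σ< h (X i)) (λ i → Σ< q (λ j → X i (h + j))))

  -- Split the square so that each pair either has j ≤ i + h or lies in the block of pairs (i, h + j),
  -- where the mirror identity followed by exchanging i and j turns the L-sum into the R-sum.
  Σ<-square-≤ : ∀ n h (L R : ℕ → ℕ → ℕ) →
    (∀ i j → j ≤ i + h → L i j ≤ R i j) → (∀ i j → L i (h + j) ≡ R j (h + i)) →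
    Σ< n (λ i → Σ< n (L i)) ≤ Σ< n (λ i → Σ< n (R i))
  Σ<-square-≤ n h L R L≤R mirror with n ≤? h
  ... | yes n≤h = Σ<-mono-≤ n (λ i _ → Σ<-mono-≤ n (λ j j<n →
                    L≤R i j (≤-trans (<⇒≤ (<-≤-trans j<n n≤h)) (m≤n+m h i))))
  ... | no n≰h = subst (λ n → Σ< n (λ i → Σ< n (L i)) ≤ Σ< n (λ i → Σ< n (R i)))
                       (m∸n+n≡m (<⇒≤ (≰⇒> n≰h))) (split-≤ (n ∸ h))
    where
    open ≤-Reasoning
    split-≤ : ∀ q → Σ< (q + h) (λ i → Σ< (q + h) (L i)) ≤ Σ< (q + h) (λ i → Σ< (q + h) (R i))
    split-≤ q = begin
      Σ< (q + h) (λ i → Σ< (q + h) (L i))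
        ≡⟨ Σ<-square-split q h L ⟩
      (Σ< q (λ i → Σ< h (L i)) + Σ< q (λ i → Σ< q (λ j → L i (h + j)))) + Σ< h (λ i → Σ< (q + h) (L (q + i)))
        ≤⟨ +-mono-≤ (+-mono-≤ near (≤-reflexive mirrored)) far ⟩
      (Σ< q (λ i → Σ< h (R i)) + Σ< q (λ i → Σ< q (λ j → R i (h + j)))) + Σ< h (λ i → Σ< (q + h) (R (q + i)))
        ≡⟨ Σ<-square-split q h R ⟨
      Σ< (q + h) (λ i → Σ< (q + h) (R i)) ∎
      where
      near : Σ< q (λ i → Σ< h (L i)) ≤ Σ< q (λ i → Σ< h (R i))
      near = Σ<-mono-≤ q (λ i _ → Σ<-mono-≤ h (λ j j<h → L≤R i j (≤-trans (<⇒≤ j<h) (m≤n+m h i))))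
      mirrored : Σ< q (λ i → Σ< q (λ j → L i (h + j))) ≡ Σ< q (λ i → Σ< q (λ j → R i (h + j)))
      mirrored = trans (Σ<-cong q (λ i → Σ<-cong q (mirror i))) (Σ<-swap q q (λ i j → R j (h + i)))
      far : Σ< h (λ i → Σ< (q + h) (L (q + i))) ≤ Σ< h (λ i → Σ< (q + h) (R (q + i)))
      far = Σ<-mono-≤ h (λ i _ → Σ<-mono-≤ (q + h) (λ j j<q+h →
              L≤R (q + i) j (≤-trans (<⇒≤ j<q+h) (+-monoˡ-≤ h (m≤m+n q i)))))

  shift-translate : ∀ h a f s → shift (h + a) f (h + s) ≡ shift a f s
  shift-translate zero    a f s = refl
  shift-translate (suc h) a f s = shift-translate h a f s

  window-logConcave : ∀ {f} → LogConcave f → ∀ c → LogConcave (window c f)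
  window-logConcave {f} lc c {a} {b} h a≤b = begin
    window c f a * window c f (b + h)
      ≡⟨ Σ<-product (suc c) (suc c) (λ i → shift i f a) (λ j → shift j f (b + h)) ⟩
    Σ< (suc c) (λ i → Σ< (suc c) (λ j → shift i f a * shift j f (b + h)))
      ≤⟨ Σ<-square-≤ (suc c) h _ _ (λ i j → shift-pair-≤ {f} lc {i = i} {j} a≤b) mirror ⟩
    Σ< (suc c) (λ i → Σ< (suc c) (λ j → shift i f b * shift j f (a + h)))
      ≡⟨ Σ<-product (suc c) (suc c) (λ i → shift i f b) (λ j → shift j f (a + h)) ⟨
    window c f b * window c f (a + h) ∎
    where
    open ≤-Reasoning
    mirror : ∀ i j → shift i f a * shift (h + j) f (b + h) ≡ shift j f b * shift (h + i) f (a + h)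
    mirror i j = begin-equality
      shift i f a * shift (h + j) f (b + h)   ≡⟨ cong (λ s → shift i f a * shift (h + j) f s) (+-comm b h) ⟩
      shift i f a * shift (h + j) f (h + b)   ≡⟨ cong (shift i f a *_) (shift-translate h j f b) ⟩
      shift i f a * shift j f b               ≡⟨ *-comm (shift i f a) _ ⟩
      shift j f b * shift i f a               ≡⟨ cong (shift j f b *_) (shift-translate h i f a) ⟨
      shift j f b * shift (h + i) f (h + a)   ≡⟨ cong (λ s → shift j f b * shift (h + i) f s) (+-comm h a) ⟩
      shift j f b * shift (h + i) f (a + h)   ∎

  RatioMonotone : (ℕ → ℕ) → (ℕ → ℕ) → Set
  RatioMonotone f g = ∀ {s t} → s ≤ t → f t * g s ≤ f s * g t

  ratioMonotone-cong : ∀ {f g g′} → g ≗ g′ → RatioMonotone f g → RatioMonotone f g′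
  ratioMonotone-cong {f} g≗g′ mono {s} {t} s≤t =
    subst₂ (λ u v → f t * u ≤ f s * v) (g≗g′ s) (g≗g′ t) (mono s≤t)

  ratioMonotone-Σ< : ∀ {f} n (G : ℕ → ℕ → ℕ) → (∀ i → RatioMonotone f (G i)) →
                     RatioMonotone f (λ s → Σ< n (λ i → G i s))
  ratioMonotone-Σ< {f} zero    G mono {s} {t} s≤t rewrite *-zeroʳ (f t) = z≤n
  ratioMonotone-Σ< {f} (suc n) G mono {s} {t} s≤t = begin
    f t * (G 0 s + Σ< n (λ i → G (suc i) s))
      ≡⟨ *-distribˡ-+ (f t) _ _ ⟩
    f t * G 0 s + f t * Σ< n (λ i → G (suc i) s)
      ≤⟨ +-mono-≤ (mono 0 s≤t) (ratioMonotone-Σ< {f} n (G ∘ suc) (mono ∘ suc) s≤t) ⟩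
    f s * G 0 t + f s * Σ< n (λ i → G (suc i) t)
      ≡⟨ *-distribˡ-+ (f s) _ _ ⟨
    f s * (G 0 t + Σ< n (λ i → G (suc i) t)) ∎
    where open ≤-Reasoning

  ratioMonotone-shift : ∀ {f} → LogConcave f → ∀ a → RatioMonotone f (shift a f)
  ratioMonotone-shift {f} lc a {s} {t} s≤t =
    subst₂ _≤_ (trans (cong (λ n → shift a f s * f n) (+-identityʳ t)) (*-comm _ (f t)))
               (trans (cong (λ n → shift a f t * f n) (+-identityʳ s)) (*-comm _ (f s)))
               (shift-pair-≤ {f} lc {i = a} {0} {0} s≤t z≤n)

  ratioMonotone-shift-window : ∀ {f g} → (∀ a → RatioMonotone f (shift a g)) →
                               ∀ c a → RatioMonotone f (shift a (window c g))
  ratioMonotone-shift-window {f} {g} mono c a =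
    ratioMonotone-cong {f} (λ s → sym (shift-window a c g s))
                       (ratioMonotone-Σ< {f} (suc c) (λ i → shift (a + i) g) (λ i → mono (a + i)))

  indicator : ℕ → ℕ → ℕ
  indicator zero    zero    = 1
  indicator zero    (suc s) = 0
  indicator (suc x) zero    = 0
  indicator (suc x) (suc s) = indicator x s

  indicator-+ : ∀ a x → indicator (a + x) ≗ shift a (indicator x)
  indicator-+ zero    x s       = refl
  indicator-+ (suc a) x zero    = refl
  indicator-+ (suc a) x (suc s) = indicator-+ a x s

  indicator-logConcave : LogConcave (indicator 0)
  indicator-logConcave {zero}  {zero}  h _ = ≤-refl
  indicator-logConcave {zero}  {suc b} h _ = z≤n
  indicator-logConcave {suc a}         h _ = z≤n

  -- count ks s = #{a ∈ box ks : |a| = s}, the coefficient of z^s in ∏ᵢ (1 + z + ⋯ + z^kᵢ).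
  count : ∀ {d} → Vec ℕ d → ℕ → ℕ
  count []ᵥ       = indicator 0
  count (c ∷ᵥ ks) = window c (count ks)

  count-logConcave : ∀ {d} (ks : Vec ℕ d) → LogConcave (count ks)
  count-logConcave []ᵥ       = indicator-logConcave
  count-logConcave (c ∷ᵥ ks) = window-logConcave {count ks} (count-logConcave ks) c

  count-removeAt : ∀ {d} (ks : Vec ℕ (suc d)) j → count ks ≗ window (lookup ks j) (count (removeAt ks j))
  count-removeAt (c ∷ᵥ ks)        zero    s = refl
  count-removeAt (c ∷ᵥ c′ ∷ᵥ ks) (suc j) s = begin
    window c (count (c′ ∷ᵥ ks)) s                 ≡⟨ window-cong c (count-removeAt (c′ ∷ᵥ ks) j) s ⟩
    window c (window kⱼ (count ks′)) s            ≡⟨ window-comm c kⱼ (count ks′) s ⟩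
    window kⱼ (window c (count ks′)) s            ∎
    where
    open ≡-Reasoning
    kⱼ = lookup (c′ ∷ᵥ ks) j
    ks′ = removeAt (c′ ∷ᵥ ks) j

  count-zero : ∀ {d} (ks : Vec ℕ d) → count ks 0 ≡ 1
  count-zero []ᵥ       = refl
  count-zero (c ∷ᵥ ks) = cong₂ _+_ (count-zero ks) (Σ<-zero c)

  AllPositive : ∀ {d} → Vec ℕ d → Set
  AllPositive {d} ks = ∀ (i : Fin d) → 0 < lookup ks i

  count-one : ∀ {d} (ks : Vec ℕ d) → AllPositive ks → count ks 1 ≡ d
  count-one []ᵥ              pos = refl
  count-one (zero ∷ᵥ ks)     pos with () ← pos zero
  count-one {suc d} (suc c ∷ᵥ ks) pos = begin
    count ks 1 + (count ks 0 + Σ< c (λ _ → 0))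
      ≡⟨ cong₂ (λ u v → u + (v + Σ< c (λ _ → 0))) (count-one ks (pos ∘ suc)) (count-zero ks) ⟩
    d + (1 + Σ< c (λ _ → 0))   ≡⟨ cong (λ v → d + suc v) (Σ<-zero c) ⟩
    d + 1                      ≡⟨ +-comm d 1 ⟩
    suc d                      ∎
    where open ≡-Reasoning

  occurrences : List ℕ → ℕ → ℕ
  occurrences []       s = 0
  occurrences (x ∷ xs) s = indicator x s + occurrences xs s

  occurrences-++ : ∀ xs ys s → occurrences (xs ++ ys) s ≡ occurrences xs s + occurrences ys s
  occurrences-++ []       ys s = refl
  occurrences-++ (x ∷ xs) ys s = trans (cong (indicator x s +_) (occurrences-++ xs ys s)) (sym (+-assoc (indicator x s) _ _))

  occurrences-sums-∷ : ∀ a (B : List (List ℕ)) → occurrences (map sum (map (a ∷_) B)) ≗ shift a (occurrences (map sum B))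
  occurrences-sums-∷ a []      s = sym (shift-zero a s)
  occurrences-sums-∷ a (b ∷ B) s = begin
    indicator (a + sum b) s + occurrences (map sum (map (a ∷_) B)) s
      ≡⟨ cong₂ _+_ (indicator-+ a (sum b) s) (occurrences-sums-∷ a B s) ⟩
    shift a (indicator (sum b)) s + shift a (occurrences (map sum B)) s
      ≡⟨ shift-distrib-+ a (indicator (sum b)) (occurrences (map sum B)) s ⟨
    shift a (occurrences (map sum (b ∷ B))) s ∎
    where open ≡-Reasoning

  occurrences-sums-concatMap : ∀ n φ (B : List (List ℕ)) →
    occurrences (map sum (concatMap (λ a → map (a ∷_) B) (applyUpTo φ n)))
      ≗ λ s → Σ< n (λ i → shift (φ i) (occurrences (map sum B)) s)
  occurrences-sums-concatMap zero    φ B s = refl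
  occurrences-sums-concatMap (suc n) φ B s = begin
    occurrences (map sum (map (φ 0 ∷_) B ++ rest)) s
      ≡⟨ cong (λ xs → occurrences xs s) (map-++ sum (map (φ 0 ∷_) B) rest) ⟩
    occurrences (map sum (map (φ 0 ∷_) B) ++ map sum rest) s
      ≡⟨ occurrences-++ (map sum (map (φ 0 ∷_) B)) (map sum rest) s ⟩
    occurrences (map sum (map (φ 0 ∷_) B)) s + occurrences (map sum rest) s
      ≡⟨ cong₂ _+_ (occurrences-sums-∷ (φ 0) B s) (occurrences-sums-concatMap n (φ ∘ suc) B s) ⟩
    Σ< (suc n) (λ i → shift (φ i) (occurrences (map sum B)) s) ∎
    where
    open ≡-Reasoning
    rest = concatMap (λ a → map (a ∷_) B) (applyUpTo (φ ∘ suc) n)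

  occurrences-box : ∀ {d} (ks : Vec ℕ d) → occurrences (map sum (box ks)) ≗ count ks
  occurrences-box []ᵥ       s = +-identityʳ _
  occurrences-box (c ∷ᵥ ks) s =
    trans (occurrences-sums-concatMap (suc c) (λ i → i) (box ks) s)
          (Σ<-cong (suc c) (λ i → shift-cong i (occurrences-box ks) s))

  moment : (ℕ → ℕ) → ℕ → ℕ
  moment f l = Σ< (suc l) (λ s → s * f s)

  moment-cong : ∀ {f g} → f ≗ g → ∀ l → moment f l ≡ moment g l
  moment-cong f≗g l = Σ<-cong (suc l) (λ s → cong (s *_) (f≗g s))

  moment-distrib-+ : ∀ f g l → moment (λ s → f s + g s) l ≡ moment f l + moment g l
  moment-distrib-+ f g l =
    trans (Σ<-cong (suc l) (λ s → *-distribˡ-+ s (f s) (g s))) (Σ<-distrib-+ (suc l) (λ s → s * f s) (λ s → s * g s))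

  moment-one : ∀ f → moment f 1 ≡ f 1
  moment-one f = trans (+-identityʳ _) (+-identityʳ _)

  moment-suc : ∀ f l → moment f (suc l) ≡ moment f l + suc l * f (suc l)
  moment-suc f l = Σ<-last (suc l) (λ s → s * f s)

  Σ<-indicator : ∀ n x → Σ< n (indicator x) ≡ (if x <ᵇ n then 1 else 0)
  Σ<-indicator zero    x       = refl
  Σ<-indicator (suc n) zero    = cong suc (Σ<-zero n)
  Σ<-indicator (suc n) (suc x) = Σ<-indicator n x

  indicator-weight : ∀ x s → s * indicator x s ≡ x * indicator x s
  indicator-weight zero    zero    = refl
  indicator-weight zero    (suc s) = *-zeroʳ (suc s)
  indicator-weight (suc x) zero    = sym (*-zeroʳ (suc x))
  indicator-weight (suc x) (suc s) = cong (indicator x s +_) (indicator-weight x s)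

  moment-indicator : ∀ x l → moment (indicator x) l ≡ (if (1 ≤ᵇ x) ∧ (x ≤ᵇ l) then x else 0)
  moment-indicator x l = begin
    Σ< (suc l) (λ s → s * indicator x s)   ≡⟨ Σ<-cong (suc l) (indicator-weight x) ⟩
    Σ< (suc l) (λ s → x * indicator x s)   ≡⟨ *-distribˡ-Σ< (suc l) x (indicator x) ⟨
    x * Σ< (suc l) (indicator x)           ≡⟨ cong (x *_) (Σ<-indicator (suc l) x) ⟩
    x * (if x <ᵇ suc l then 1 else 0)      ≡⟨ scale x ⟩
    (if (1 ≤ᵇ x) ∧ (x ≤ᵇ l) then x else 0) ∎
    where
    open ≡-Reasoning
    scale : ∀ x → x * (if x <ᵇ suc l then 1 else 0) ≡ (if (1 ≤ᵇ x) ∧ (x ≤ᵇ l) then x else 0)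
    scale zero = refl
    scale (suc x) with x <ᵇ l
    ... | true  = *-identityʳ (suc x)
    ... | false = *-zeroʳ (suc x)

  sum-filterᵇ-∷ : ∀ (p : ℕ → Bool) x xs → sum (filterᵇ p (x ∷ xs)) ≡ (if p x then x else 0) + sum (filterᵇ p xs)
  sum-filterᵇ-∷ p x xs with p x
  ... | true  = refl
  ... | false = refl

  sum-filter-moment : ∀ l xs → sum (filterᵇ (λ s → (1 ≤ᵇ s) ∧ (s ≤ᵇ l)) xs) ≡ moment (occurrences xs) l
  sum-filter-moment l []       = sym (trans (Σ<-cong (suc l) *-zeroʳ) (Σ<-zero (suc l)))
  sum-filter-moment l (x ∷ xs) = begin
    sum (filterᵇ inRange (x ∷ xs))
      ≡⟨ sum-filterᵇ-∷ inRange x xs ⟩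
    (if inRange x then x else 0) + sum (filterᵇ inRange xs)
      ≡⟨ cong₂ _+_ (sym (moment-indicator x l)) (sum-filter-moment l xs) ⟩
    moment (indicator x) l + moment (occurrences xs) l
      ≡⟨ moment-distrib-+ (indicator x) (occurrences xs) l ⟨
    moment (occurrences (x ∷ xs)) l ∎
    where
    open ≡-Reasoning
    inRange = λ s → (1 ≤ᵇ s) ∧ (s ≤ᵇ l)

  𝒦-moment : ∀ {d} (ks : Vec ℕ d) l → 𝒦 ks l ≡ moment (count ks) l
  𝒦-moment ks l = trans (sum-filter-moment l (map sum (box ks))) (moment-cong (occurrences-box ks) l)

  moment-≤-suc : ∀ f l → moment f l ≤ moment f (suc l)
  moment-≤-suc f l = ≤-trans (m≤m+n _ _) (≤-reflexive (sym (moment-suc f l)))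

  ≤-moment : ∀ f l → f 1 ≤ moment f (suc l)
  ≤-moment f l = ≤-trans (≤-reflexive (sym (+-identityʳ (f 1)))) (m≤m+n (1 * f 1) _)

  length≤𝒦 : ∀ {t} (T : Vec ℕ t) → AllPositive T → ∀ l → t ≤ 𝒦 T (suc l)
  length≤𝒦 T pos l = subst₂ _≤_ (count-one T pos) (sym (𝒦-moment T (suc l))) (≤-moment (count T) l)

  𝒦-≤-suc : ∀ {t} (T : Vec ℕ t) l → 𝒦 T l ≤ 𝒦 T (suc l)
  𝒦-≤-suc T l = subst₂ _≤_ (sym (𝒦-moment T l)) (sym (𝒦-moment T (suc l))) (moment-≤-suc (count T) l)

  moment-linear-≤ : ∀ f g a b e c l → (∀ s → 2 ≤ s → s ≤ suc l → a * g s ≤ f s * b + e * g s) →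
                    a * g 1 + c ≤ f 1 * b + e * g 1 →
                    a * moment g (suc l) + c ≤ moment f (suc l) * b + e * moment g (suc l)
  moment-linear-≤ f g a b e c zero    _    base
    rewrite moment-one f | moment-one g = base
  moment-linear-≤ f g a b e c (suc l) term base = begin
    a * moment g (2 + l) + c
      ≡⟨ cong (λ G → a * G + c) (moment-suc g (suc l)) ⟩
    a * (G + n * g n) + c
      ≡⟨ split-last a G n (g n) c ⟩
    (a * G + c) + n * (a * g n)
      ≤⟨ +-mono-≤ (moment-linear-≤ f g a b e c l (λ s 2≤s s≤1+l → term s 2≤s (m≤n⇒m≤1+n s≤1+l)) base)
                  (*-monoʳ-≤ n (term n (s≤s (s≤s z≤n)) ≤-refl)) ⟩
    (F * b + e * G) + n * (f n * b + e * g n)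
      ≡⟨ join-last F b e G n (f n) (g n) ⟩
    (F + n * f n) * b + e * (G + n * g n)
      ≡⟨ cong₂ (λ F′ G′ → F′ * b + e * G′) (moment-suc f (suc l)) (moment-suc g (suc l)) ⟨
    moment f (2 + l) * b + e * moment g (2 + l) ∎
    where
    open ≤-Reasoning
    n = 2 + l
    F = moment f (suc l)
    G = moment g (suc l)
    split-last : ∀ a G n x c → a * (G + n * x) + c ≡ (a * G + c) + n * (a * x)
    split-last = solve-∀
    join-last : ∀ F b e G n y x → (F * b + e * G) + n * (y * b + e * x) ≡ (F + n * y) * b + e * (G + n * x)
    join-last = solve-∀

  -- With k = l + 2 and d = t + m: if Pₖ d + m Nₖ ≤ t Nₖ, the monotonicity of N/P gives the first alternative;
  -- otherwise it spreads the reverse inequality to t Nₛ ≤ Pₛ d + m Nₛ for all s ≤ k, giving the second.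
  module _ {P N : ℕ → ℕ} (t m l : ℕ) (P₁ : P 1 ≡ t) (N₁ : N 1 ≡ t + m) (mono : RatioMonotone P N) where

    moment-dichotomyˡ : P (2 + l) * (t + m) + m * N (2 + l) ≤ t * N (2 + l) →
      moment P (2 + l) * moment N (suc l) + m * moment N (2 + l) ≤ moment P (suc l) * moment N (2 + l) + m * moment N (suc l)
    moment-dichotomyˡ small = begin
      moment P k * K′ + m * moment N k
        ≡⟨ cong₂ (λ W K → W * K′ + m * K) (moment-suc P (suc l)) (moment-suc N (suc l)) ⟩
      (v + k * P k) * K′ + m * (K′ + k * N k)
        ≡⟨ expand v (P k) K′ m (N k) k ⟩
      (v * K′ + m * K′) + k * (P k * K′ + m * N k)
        ≤⟨ +-monoʳ-≤ (v * K′ + m * K′) (*-monoʳ-≤ k top) ⟩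
      (v * K′ + m * K′) + k * (v * N k)
        ≡⟨ collect v K′ m (N k) k ⟩
      v * (K′ + k * N k) + m * K′
        ≡⟨ cong (λ K → v * K + m * K′) (moment-suc N (suc l)) ⟨
      v * moment N k + m * K′ ∎
      where
      open ≤-Reasoning
      k = 2 + l
      v = moment P (suc l)
      K′ = moment N (suc l)
      expand : ∀ v p K′ m n k → (v + k * p) * K′ + m * (K′ + k * n) ≡ (v * K′ + m * K′) + k * (p * K′ + m * n)
      expand = solve-∀
      collect : ∀ v K′ m n k → (v * K′ + m * K′) + k * (v * n) ≡ v * (K′ + k * n) + m * K′
      collect = solve-∀
      top : P k * K′ + m * N k ≤ v * N k
      top = subst₂ _≤_ refl (+-identityʳ _)
        (moment-linear-≤ P N (P k) (N k) 0 (m * N k) l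
          (λ s _ s≤1+l → ≤-trans (mono (m≤n⇒m≤1+n s≤1+l)) (≤-reflexive (sym (+-identityʳ _))))
          (subst₂ (λ n p → P k * n + m * N k ≤ p * N k + 0) (sym N₁) (sym P₁)
            (≤-trans small (≤-reflexive (sym (+-identityʳ _))))))

    moment-dichotomyʳ : NonZero (N (2 + l)) → t * N (2 + l) ≤ P (2 + l) * (t + m) + m * N (2 + l) →
      t * moment N (suc l) + m * (t + m) ≤ moment P (suc l) * (t + m) + m * moment N (suc l)
    moment-dichotomyʳ Nₖ≢0 large =
      moment-linear-≤ P N t d m (m * d) l (λ s _ s≤1+l → termwise (m≤n⇒m≤1+n s≤1+l))
        (subst₂ (λ n p → t * n + m * d ≤ p * d + m * n) (sym N₁) (sym P₁) ≤-refl)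
      where
      open ≤-Reasoning
      k = 2 + l
      d = t + m
      regroup : ∀ n t s → n * (t * s) ≡ s * (t * n)
      regroup = solve-∀
      spread : ∀ s p d m n → s * (p * d + m * n) ≡ (p * s) * d + m * s * n
      spread = solve-∀
      gather : ∀ p n d m s → (p * n) * d + m * s * n ≡ n * (p * d + m * s)
      gather = solve-∀
      termwise : ∀ {s} → s ≤ k → t * N s ≤ P s * d + m * N s
      termwise {s} s≤k = *-cancelˡ-≤ (N k) ⦃ Nₖ≢0 ⦄ (begin
        N k * (t * N s)                  ≡⟨ regroup (N k) t (N s) ⟩
        N s * (t * N k)                  ≤⟨ *-monoʳ-≤ (N s) large ⟩
        N s * (P k * d + m * N k)        ≡⟨ spread (N s) (P k) d m (N k) ⟩
        (P k * N s) * d + m * N s * N k  ≤⟨ +-monoˡ-≤ (m * N s * N k) (*-monoˡ-≤ d (mono s≤k)) ⟩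
        (P s * N k) * d + m * N s * N k  ≡⟨ gather (P s) (N k) d m (N s) ⟩
        N k * (P s * d + m * N s)        ∎)

    moment-dichotomy : P 0 ≡ 1 → N 0 ≡ 1 →
      (moment P (2 + l) * moment N (suc l) + m * moment N (2 + l) ≤ moment P (suc l) * moment N (2 + l) + m * moment N (suc l))
      ⊎ (t * moment N (suc l) + m * (t + m) ≤ moment P (suc l) * (t + m) + m * moment N (suc l))
    moment-dichotomy P₀ N₀ with P (2 + l) * (t + m) + m * N (2 + l) ≤? t * N (2 + l)
    ... | yes small = inj₁ (moment-dichotomyˡ small)
    ... | no ¬small = inj₂ (moment-dichotomyʳ (≢-nonZero Nₖ≢0) (<⇒≤ (≰⇒> ¬small)))
      where
      k = 2 + l
      d = t + m
      Pₖ≤Nₖ : P k ≤ N k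
      Pₖ≤Nₖ = subst₂ _≤_ (trans (cong (P k *_) N₀) (*-identityʳ _)) (trans (cong (_* N k) P₀) (*-identityˡ _)) (mono z≤n)
      Nₖ≢0 : N k ≢ 0
      Nₖ≢0 Nₖ≡0 = ¬small (subst₂ (λ p n → p * d + m * n ≤ t * n) (sym Pₖ≡0) (sym Nₖ≡0)
                                  (≤-reflexive (trans (*-zeroʳ m) (sym (*-zeroʳ t)))))
        where
        Pₖ≡0 : P k ≡ 0
        Pₖ≡0 = n≤0⇒n≡0 (subst (P k ≤_) Nₖ≡0 Pₖ≤Nₖ)

  data Deletion : ∀ {d t} → Vec ℕ d → Vec ℕ t → ℕ → Set where
    none : ∀ {d} {ks : Vec ℕ d} → Deletion ks ks 0
    del  : ∀ {d t m} {ks : Vec ℕ (suc d)} {T : Vec ℕ t} (j : Fin (suc d)) →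
           Deletion (removeAt ks j) T m → Deletion ks T (suc m)

  deletion-length : ∀ {d t m} {ks : Vec ℕ d} {T : Vec ℕ t} → Deletion ks T m → d ≡ t + m
  deletion-length                 none        = sym (+-identityʳ _)
  deletion-length {t = t} {suc m} (del j rest) = trans (cong suc (deletion-length rest)) (sym (+-suc t m))

  deletion-removeAt : ∀ {d t m} {ks : Vec ℕ d} {T : Vec ℕ (suc t)} → Deletion ks T m → ∀ j →
                      Deletion ks (removeAt T j) (suc m)
  deletion-removeAt none         j = del j none
  deletion-removeAt (del i rest) j = del i (deletion-removeAt rest j)

  removeAt-positive : ∀ {d} (ks : Vec ℕ (suc d)) j → AllPositive ks → AllPositive (removeAt ks j)
  removeAt-positive (c ∷ᵥ ks)       zero    pos i       = pos (suc i)
  removeAt-positive (c ∷ᵥ c′ ∷ᵥ ks) (suc j) pos zero    = pos zero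
  removeAt-positive (c ∷ᵥ c′ ∷ᵥ ks) (suc j) pos (suc i) = removeAt-positive (c′ ∷ᵥ ks) j (pos ∘ suc) i

  deletion-positive : ∀ {d t m} {ks : Vec ℕ d} {T : Vec ℕ t} → Deletion ks T m → AllPositive ks → AllPositive T
  deletion-positive                none         pos = pos
  deletion-positive {ks = ks} (del j rest) pos = deletion-positive rest (removeAt-positive ks j pos)

  -- Generalising over the shift a is what makes the induction go through: a window turns the shift a
  -- into a sum of the shifts a + i.
  deletion-ratioMonotone-shift : ∀ {d t m} {ks : Vec ℕ d} {T : Vec ℕ t} → Deletion ks T m →
                                 ∀ a → RatioMonotone (count T) (shift a (count ks))
  deletion-ratioMonotone-shift {T = T} none a = ratioMonotone-shift {count T} (count-logConcave T) a
  deletion-ratioMonotone-shift {ks = ks} {T} (del j rest) a =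
    ratioMonotone-cong {count T} (shift-cong a (λ s → sym (count-removeAt ks j s)))
      (ratioMonotone-shift-window {count T} (deletion-ratioMonotone-shift rest) (lookup ks j) a)

  deletion-dichotomy : ∀ {d t m} {ks : Vec ℕ d} {T : Vec ℕ t} → AllPositive ks → Deletion ks T m → ∀ l →
    (𝒦 T (2 + l) * 𝒦 ks (1 + l) + m * 𝒦 ks (2 + l) ≤ 𝒦 T (1 + l) * 𝒦 ks (2 + l) + m * 𝒦 ks (1 + l))
    ⊎ (t * 𝒦 ks (1 + l) + m * (t + m) ≤ 𝒦 T (1 + l) * (t + m) + m * 𝒦 ks (1 + l))
  deletion-dichotomy {t = t} {m} {ks} {T} pos deleted l
    rewrite 𝒦-moment T (2 + l) | 𝒦-moment T (1 + l) | 𝒦-moment ks (2 + l) | 𝒦-moment ks (1 + l) =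
    moment-dichotomy {count T} {count ks} t m l (count-one T (deletion-positive deleted pos))
      (trans (count-one ks pos) (deletion-length deleted))
      (deletion-ratioMonotone-shift deleted 0) (count-zero T) (count-zero ks)

module GammaComparison where

  open import Data.Empty using (⊥-elim)
  open import Data.Integer as ℤ using (+_)
  import Data.Integer.Properties as ℤ
  open import Data.List using (List; foldr; map; allFin)
  open import Data.List.Membership.Propositional.Properties using (∈-allFin)
  open import Data.List.Properties using (foldr-preservesᵇ; foldr-preservesᵒ)
  open import Data.List.Relation.Unary.All using (All)
  import Data.List.Relation.Unary.All.Properties as All
  open import Data.List.Relation.Unary.Any as Any using (Any)
  import Data.List.Relation.Unary.Any.Properties as Any
  open import Data.Nat as ℕ using (ℕ; zero; suc)
  import Data.Nat.Coprimality as Coprime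
  import Data.Nat.Properties as ℕ
  open import Data.Rational
  open import Data.Rational.Properties
  open import Data.Rational.Solver using (module +-*-Solver)
  open +-*-Solver using (solve; _:+_; _:*_; _:-_; _:=_; con)
  open import Data.Sum using (_⊎_; inj₁; inj₂; [_,_]′)
  open import Data.Vec using (Vec; removeAt)
  open import Relation.Binary.PropositionalEquality
  open import Relation.Nullary using (yes; no)
  open import Defs using (ℕ→ℚ; inv; 𝒦; γ)
  open Coefficients
    using (Deletion; none; del; AllPositive; deletion-length; deletion-removeAt; deletion-positive; deletion-dichotomy;
           length≤𝒦; 𝒦-≤-suc)

  ℕ→ℚ-mkℚ : ∀ n → ℕ→ℚ n ≡ mkℚ (+ n) 0 (Coprime.sym (Coprime.1-coprimeTo n))
  ℕ→ℚ-mkℚ n = normalize-coprime (Coprime.sym (Coprime.1-coprimeTo n))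

  ℕ→ℚ-+ : ∀ a b → ℕ→ℚ (a ℕ.+ b) ≡ ℕ→ℚ a + ℕ→ℚ b
  ℕ→ℚ-+ a b rewrite ℕ→ℚ-mkℚ a | ℕ→ℚ-mkℚ b =
    trans (ℕ→ℚ-mkℚ (a ℕ.+ b)) (sym (trans (/-cong {p₂ = + (a ℕ.+ b)} {q₂ = 1} numerator refl) (ℕ→ℚ-mkℚ (a ℕ.+ b))))
    where
    numerator : + a ℤ.* + 1 ℤ.+ + b ℤ.* + 1 ≡ + (a ℕ.+ b)
    numerator = trans (cong₂ ℤ._+_ (ℤ.*-identityʳ (+ a)) (ℤ.*-identityʳ (+ b))) (sym (ℤ.pos-+ a b))

  ℕ→ℚ-* : ∀ a b → ℕ→ℚ (a ℕ.* b) ≡ ℕ→ℚ a * ℕ→ℚ b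
  ℕ→ℚ-* a b rewrite ℕ→ℚ-mkℚ a | ℕ→ℚ-mkℚ b =
    trans (ℕ→ℚ-mkℚ (a ℕ.* b)) (sym (trans (/-cong {p₂ = + (a ℕ.* b)} {q₂ = 1} (sym (ℤ.pos-* a b)) refl) (ℕ→ℚ-mkℚ (a ℕ.* b))))

  ℕ→ℚ-mono-≤ : ∀ {a b} → a ℕ.≤ b → ℕ→ℚ a ≤ ℕ→ℚ b
  ℕ→ℚ-mono-≤ {a} {b} a≤b rewrite ℕ→ℚ-mkℚ a | ℕ→ℚ-mkℚ b =
    *≤* (subst₂ ℤ._≤_ (sym (ℤ.*-identityʳ (+ a))) (sym (ℤ.*-identityʳ (+ b))) (ℤ.+≤+ a≤b))

  ℕ→ℚ-mono-< : ∀ {a b} → a ℕ.< b → ℕ→ℚ a < ℕ→ℚ b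
  ℕ→ℚ-mono-< {a} {b} a<b rewrite ℕ→ℚ-mkℚ a | ℕ→ℚ-mkℚ b =
    *<* (subst₂ ℤ._<_ (sym (ℤ.*-identityʳ (+ a))) (sym (ℤ.*-identityʳ (+ b))) (ℤ.+<+ a<b))

  ℕ→ℚ-nonNeg : ∀ a → 0ℚ ≤ ℕ→ℚ a
  ℕ→ℚ-nonNeg a = ℕ→ℚ-mono-≤ {0} {a} ℕ.z≤n

  ℕ→ℚ-suc-* : ∀ m X → ℕ→ℚ (suc m) * X ≡ X + ℕ→ℚ m * X
  ℕ→ℚ-suc-* m X =
    trans (cong (_* X) (ℕ→ℚ-+ 1 m)) (trans (*-distribʳ-+ X 1ℚ (ℕ→ℚ m)) (cong (_+ ℕ→ℚ m * X) (*-identityˡ X)))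

  ℕ→ℚ-+-* : ∀ a b c e → ℕ→ℚ (a ℕ.* b ℕ.+ c ℕ.* e) ≡ ℕ→ℚ a * ℕ→ℚ b + ℕ→ℚ c * ℕ→ℚ e
  ℕ→ℚ-+-* a b c e = trans (ℕ→ℚ-+ (a ℕ.* b) (c ℕ.* e)) (cong₂ _+_ (ℕ→ℚ-* a b) (ℕ→ℚ-* c e))

  *-inv : ∀ {q} → 0ℚ < q → q * inv q ≡ 1ℚ
  *-inv {q} 0<q with q ≟ 0ℚ
  ... | yes q≡0 = ⊥-elim (<-irrefl (sym q≡0) 0<q)
  ... | no  q≢0 = *-inverseʳ q ⦃ ≢-nonZero q≢0 ⦄

  inv-pos : ∀ {q} → 0ℚ < q → 0ℚ < inv q
  inv-pos {q} 0<q with q ≟ 0ℚ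
  ... | yes q≡0 = ⊥-elim (<-irrefl (sym q≡0) 0<q)
  ... | no  q≢0 = positive⁻¹ _ ⦃ 1/pos⇒pos q ⦃ positive 0<q ⦄ ⦄

  ≤⇒0≤- : ∀ {p q} → p ≤ q → 0ℚ ≤ q - p
  ≤⇒0≤- {p} {q} p≤q = subst (_≤ q - p) (+-inverseʳ p) (+-monoˡ-≤ (- p) p≤q)

  0≤-⇒≤ : ∀ {p q} → 0ℚ ≤ q - p → p ≤ q
  0≤-⇒≤ {p} {q} 0≤q-p = subst₂ _≤_ (+-identityʳ p) (p+[q-p]≡q p q) (+-monoʳ-≤ p 0≤q-p)
    where
    p+[q-p]≡q : ∀ p q → p + (q - p) ≡ q
    p+[q-p]≡q = solve 2 (λ p q → p :+ (q :- p) := q) refl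

  0≤* : ∀ {p q} → 0ℚ ≤ p → 0ℚ ≤ q → 0ℚ ≤ p * q
  0≤* {p} {q} 0≤p 0≤q = nonNegative⁻¹ _ ⦃ nonNeg*nonNeg⇒nonNeg p ⦃ nonNegative 0≤p ⦄ q ⦃ nonNegative 0≤q ⦄ ⦄

  half-+-≤ : ∀ T M X → X ≤ ½ → 0ℚ ≤ M → T * ½ + M * X ≤ (T + M) * ½
  half-+-≤ T M X X≤½ 0≤M = 0≤-⇒≤ (subst (0ℚ ≤_) (sym (gap T M X ½)) (0≤* 0≤M (≤⇒0≤- X≤½)))
    where
    gap : ∀ T M X h → (T + M) * h - (T * h + M * X) ≡ M * (h - X)
    gap = solve 4 (λ T M X h → (T :+ M) :* h :- (T :* h :+ M :* X) := M :* (h :- X)) refl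

  -- With Y K = X K′, multiplying the difference of the two sides by K gives X times the slack of the hypothesis.
  rescaled-deficit-≤ : ∀ T M V W K′ K X Y → 0ℚ ≤ X → 0ℚ < K → Y * K ≡ X * K′ →
    W * K′ + M * K ≤ V * K + M * K′ → (T - V * X) + M * X ≤ (T - W * Y) + M * Y
  rescaled-deficit-≤ T M V W K′ K X Y 0≤X 0<K YK≡XK′ slack =
    0≤-⇒≤ (*-cancelˡ-≤-pos K ⦃ positive 0<K ⦄ (subst₂ _≤_ (sym (*-zeroʳ K)) (sym scaled) (0≤* 0≤X (≤⇒0≤- slack))))
    where
    expand : ∀ T M V W X Y K → K * (((T - W * Y) + M * Y) - ((T - V * X) + M * X))
                              ≡ V * X * K - M * X * K - W * (Y * K) + M * (Y * K)
    expand = solve 7 (λ T M V W X Y K → K :* (((T :- W :* Y) :+ M :* Y) :- ((T :- V :* X) :+ M :* X))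
                                    := V :* X :* K :- M :* X :* K :- W :* (Y :* K) :+ M :* (Y :* K)) refl
    factor : ∀ M V W X K K′ → V * X * K - M * X * K - W * (X * K′) + M * (X * K′)
                            ≡ X * ((V * K + M * K′) - (W * K′ + M * K))
    factor = solve 6 (λ M V W X K K′ → V :* X :* K :- M :* X :* K :- W :* (X :* K′) :+ M :* (X :* K′)
                                   := X :* ((V :* K :+ M :* K′) :- (W :* K′ :+ M :* K))) refl
    scaled : K * (((T - W * Y) + M * Y) - ((T - V * X) + M * X)) ≡ X * ((V * K + M * K′) - (W * K′ + M * K))
    scaled = trans (expand T M V W X Y K)
                   (trans (cong (λ z → V * X * K - M * X * K - W * z + M * z) YK≡XK′) (factor M V W X K K′))

  0<*⇒0< : ∀ {p q} → 0ℚ < p * q → 0ℚ ≤ q → 0ℚ < p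
  0<*⇒0< {p} {q} 0<pq 0≤q with 0ℚ <? p
  ... | yes 0<p = 0<p
  ... | no  0≮p = ⊥-elim (<-irrefl refl (<-≤-trans 0<pq
                    (subst (p * q ≤_) (*-zeroˡ q) (*-monoʳ-≤-nonNeg q ⦃ nonNegative 0≤q ⦄ (≮⇒≥ 0≮p)))))

  -- Once the left side L exceeds (T + M)/2 one gets T > M, and (T − M)((T + M) − K′X − L) = X·slack + M(2L − (T + M)) ≥ 0.
  deficit-≤-half-or-top-deficit : ∀ T M V K′ X → 0ℚ ≤ X → X ≤ ½ → T ≤ V → 0ℚ ≤ M →
    T * K′ + M * (T + M) ≤ V * (T + M) + M * K′ →
    ((T - V * X) + M * X ≤ (T + M) * ½) ⊎ ((T - V * X) + M * X ≤ (T + M) - K′ * X)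
  deficit-≤-half-or-top-deficit T M V K′ X 0≤X X≤½ T≤V 0≤M slack with (T - V * X) + M * X ≤? (T + M) * ½
  ... | yes L≤half = inj₁ L≤half
  ... | no  L≰half = inj₂ (0≤-⇒≤ (*-cancelˡ-≤-pos (T - M) ⦃ positive 0<T-M ⦄
          (subst₂ _≤_ (sym (*-zeroʳ (T - M))) (sym (rest-identity T M V K′ X))
            (+-mono-≤ (0≤* 0≤X (≤⇒0≤- slack)) (0≤* 0≤M (<⇒≤ 0<excess))))))
    where
    L = (T - V * X) + M * X
    twice-half : ∀ q → q * ½ + q * ½ ≡ q
    twice-half q = trans (sym (*-distribˡ-+ q ½ ½)) (*-identityʳ q)
    0<excess : 0ℚ < (L + L) - (T + M)
    0<excess = subst (_< (L + L) - (T + M)) (+-inverseʳ (T + M))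
      (+-monoˡ-< (- (T + M)) (subst (_< L + L) (twice-half (T + M)) (+-mono-< (≰⇒> L≰half) (≰⇒> L≰half))))
    excess-identity : ∀ T M V X → (T - M) * (1ℚ - (X + X))
      ≡ ((((T - V * X) + M * X) + ((T - V * X) + M * X)) - (T + M)) + (V - T) * (X + X)
    excess-identity = solve 4 (λ T M V X → (T :- M) :* (con 1ℚ :- (X :+ X))
      := ((((T :- V :* X) :+ M :* X) :+ ((T :- V :* X) :+ M :* X)) :- (T :+ M)) :+ (V :- T) :* (X :+ X)) refl
    rest-identity : ∀ T M V K′ X → (T - M) * (((T + M) - K′ * X) - ((T - V * X) + M * X))
      ≡ X * ((V * (T + M) + M * K′) - (T * K′ + M * (T + M))) + M * ((((T - V * X) + M * X) + ((T - V * X) + M * X)) - (T + M))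
    rest-identity = solve 5 (λ T M V K′ X → (T :- M) :* (((T :+ M) :- K′ :* X) :- ((T :- V :* X) :+ M :* X))
      := X :* ((V :* (T :+ M) :+ M :* K′) :- (T :* K′ :+ M :* (T :+ M)))
         :+ M :* ((((T :- V :* X) :+ M :* X) :+ ((T :- V :* X) :+ M :* X)) :- (T :+ M))) refl
    0<T-M : 0ℚ < T - M
    0<T-M = 0<*⇒0< (subst (0ℚ <_) (sym (excess-identity T M V X))
                      (subst (_< ((L + L) - (T + M)) + (V - T) * (X + X)) (+-identityʳ 0ℚ)
                        (+-mono-<-≤ 0<excess (0≤* (≤⇒0≤- T≤V) (+-mono-≤ 0≤X 0≤X)))))
                   (≤⇒0≤- (subst (X + X ≤_) (twice-half 1ℚ) (+-mono-≤ X≤½ X≤½)))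

  foldr-⊔-lub : ∀ {c r} z xs → z + c ≤ r → All (λ e → e + c ≤ r) xs → foldr _⊔_ z xs + c ≤ r
  foldr-⊔-lub {c} {r} z xs z+c≤r =
    foldr-preservesᵇ (λ {a} {b} a+c≤r b+c≤r →
      subst (_≤ r) (sym (mono-≤-distrib-⊔ (+-monoˡ-≤ c) a b)) (⊔-lub a+c≤r b+c≤r)) z+c≤r

  foldr-⊔-upper : ∀ {e} z xs → (e ≤ z) ⊎ Any (e ≤_) xs → e ≤ foldr _⊔_ z xs
  foldr-⊔-upper z xs =
    foldr-preservesᵒ (λ a b → [ (λ e≤a → ≤-trans e≤a (p≤p⊔q a b)) , (λ e≤b → ≤-trans e≤b (p≤q⊔p a b)) ]′) z xs

  module _ {t} (T : Vec ℕ (suc t)) (k : ℕ) (p : ℚ) where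

    private
      half deficit : ℚ
      half = ℕ→ℚ (suc t) * ½
      deficit = ℕ→ℚ (suc t) - ℕ→ℚ (𝒦 T (suc k)) * inv p
      removals : List ℚ
      removals = map (λ j → γ t (removeAt T j) (suc k) p + inv p) (allFin (suc t))

    half≤γ : ℕ→ℚ (suc t) * ½ ≤ γ (suc t) T (suc k) p
    half≤γ = foldr-⊔-upper (half ⊔ deficit) removals (inj₁ (p≤p⊔q half deficit))

    deficit≤γ : ℕ→ℚ (suc t) - ℕ→ℚ (𝒦 T (suc k)) * inv p ≤ γ (suc t) T (suc k) p
    deficit≤γ = foldr-⊔-upper (half ⊔ deficit) removals (inj₁ (p≤q⊔p half deficit))

    γ-removeAt≤γ : ∀ j → γ t (removeAt T j) (suc k) p + inv p ≤ γ (suc t) T (suc k) p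
    γ-removeAt≤γ j = foldr-⊔-upper (half ⊔ deficit) removals (inj₂ (Any.map⁺ (Any.map (λ { refl → ≤-refl }) (∈-allFin j))))

    γ-lub : ∀ {c r} → ℕ→ℚ (suc t) * ½ + c ≤ r → (ℕ→ℚ (suc t) - ℕ→ℚ (𝒦 T (suc k)) * inv p) + c ≤ r →
            (∀ j → (γ t (removeAt T j) (suc k) p + inv p) + c ≤ r) → γ (suc t) T (suc k) p + c ≤ r
    γ-lub {c} {r} half≤ deficit≤ removed≤ =
      foldr-⊔-lub (half ⊔ deficit) removals
        (subst (_≤ r) (sym (mono-≤-distrib-⊔ (+-monoˡ-≤ c) half deficit)) (⊔-lub half≤ deficit≤))
        (All.map⁺ (All.tabulate⁺ removed≤))

  γ-deletion : ∀ k p {d t m} {ks : Vec ℕ d} {T : Vec ℕ t} → Deletion ks T m →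
               γ t T (suc k) p + ℕ→ℚ m * inv p ≤ γ d ks (suc k) p
  γ-deletion k p {t = t} {T = T} none = ≤-reflexive (trans (cong (λ z → γ t T (suc k) p + z) (*-zeroˡ (inv p))) (+-identityʳ _))
  γ-deletion k p {t = t} {suc m} {ks} {T} (del j rest) = begin
    γ t T (suc k) p + ℕ→ℚ (suc m) * inv p           ≡⟨ cong (λ z → γ t T (suc k) p + z) (ℕ→ℚ-suc-* m (inv p)) ⟩
    γ t T (suc k) p + (inv p + ℕ→ℚ m * inv p)       ≡⟨ cong (λ z → γ t T (suc k) p + z) (+-comm (inv p) _) ⟩
    γ t T (suc k) p + (ℕ→ℚ m * inv p + inv p)       ≡⟨ +-assoc (γ t T (suc k) p) _ (inv p) ⟨
    (γ t T (suc k) p + ℕ→ℚ m * inv p) + inv p       ≤⟨ +-monoˡ-≤ (inv p) (γ-deletion k p rest) ⟩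
    γ _ (removeAt ks j) (suc k) p + inv p           ≤⟨ γ-removeAt≤γ ks k p j ⟩
    γ _ ks (suc k) p                                ∎
    where open ≤-Reasoning

  ℕ→ℚ-deletion-length : ∀ {d t m} {ks : Vec ℕ d} {T : Vec ℕ t} → Deletion ks T m → ℕ→ℚ d ≡ ℕ→ℚ t + ℕ→ℚ m
  ℕ→ℚ-deletion-length {t = t} {m} deleted = trans (cong ℕ→ℚ (deletion-length deleted)) (ℕ→ℚ-+ t m)

  module Comparison {d} (ks : Vec ℕ (suc d)) (pos : AllPositive ks) (l : ℕ) (p : ℚ) (2≤p : ℕ→ℚ 2 ≤ p) where

    K′ K : ℕ
    K′ = 𝒦 ks (suc l)
    K  = 𝒦 ks (suc (suc l))

    p′ x y R : ℚ
    p′ = p * ℕ→ℚ K * inv (ℕ→ℚ K′)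
    x = inv p
    y = inv p′
    R = γ (suc d) ks (suc (suc l)) p′

    0<K′ : 0ℚ < ℕ→ℚ K′
    0<K′ = ℕ→ℚ-mono-< (ℕ.<-≤-trans (ℕ.s≤s ℕ.z≤n) (length≤𝒦 ks pos l))

    0<K : 0ℚ < ℕ→ℚ K
    0<K = <-≤-trans 0<K′ (ℕ→ℚ-mono-≤ (𝒦-≤-suc ks (suc l)))

    0<p : 0ℚ < p
    0<p = <-≤-trans (ℕ→ℚ-mono-< {0} {2} (ℕ.s≤s ℕ.z≤n)) 2≤p

    0≤x : 0ℚ ≤ x
    0≤x = <⇒≤ (inv-pos 0<p)

    x≤½ : x ≤ ½
    x≤½ = begin
      x                    ≡⟨ trans (sym (*-identityˡ x)) (*-assoc ½ (ℕ→ℚ 2) x) ⟩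
      ½ * (ℕ→ℚ 2 * x)      ≤⟨ *-monoˡ-≤-nonNeg ½ (*-monoʳ-≤-nonNeg x ⦃ nonNegative 0≤x ⦄ 2≤p) ⟩
      ½ * (p * x)          ≡⟨ cong (½ *_) (*-inv 0<p) ⟩
      ½ * 1ℚ               ≡⟨ *-identityʳ ½ ⟩
      ½                    ∎
      where open ≤-Reasoning

    0<p′ : 0ℚ < p′
    0<p′ = pos* (pos* 0<p 0<K) (inv-pos 0<K′)
      where
      pos* : ∀ {a b} → 0ℚ < a → 0ℚ < b → 0ℚ < a * b
      pos* {a} {b} 0<a 0<b = positive⁻¹ _ ⦃ pos*pos⇒pos a ⦃ positive 0<a ⦄ b ⦃ positive 0<b ⦄ ⦄

    yK≡xK′ : y * ℕ→ℚ K ≡ x * ℕ→ℚ K′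
    yK≡xK′ = begin
      y * ℕ→ℚ K
        ≡⟨ *-identityʳ _ ⟨
      (y * ℕ→ℚ K) * 1ℚ
        ≡⟨ cong ((y * ℕ→ℚ K) *_) (cong₂ _*_ (*-inv 0<p) (*-inv 0<K′)) ⟨
      (y * ℕ→ℚ K) * ((p * x) * (ℕ→ℚ K′ * inv (ℕ→ℚ K′)))
        ≡⟨ regroup y (ℕ→ℚ K) p x (ℕ→ℚ K′) (inv (ℕ→ℚ K′)) ⟩
      (p′ * y) * (x * ℕ→ℚ K′)
        ≡⟨ cong (_* (x * ℕ→ℚ K′)) (*-inv 0<p′) ⟩
      1ℚ * (x * ℕ→ℚ K′)
        ≡⟨ *-identityˡ _ ⟩
      x * ℕ→ℚ K′ ∎
      where
      open ≡-Reasoning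
      regroup : ∀ y K p x K′ i → (y * K) * ((p * x) * (K′ * i)) ≡ (p * K * i * y) * (x * K′)
      regroup = solve 6 (λ y K p x K′ i → (y :* K) :* ((p :* x) :* (K′ :* i)) := (p :* K :* i :* y) :* (x :* K′)) refl

    module _ {t m} {T : Vec ℕ (suc t)} (deleted : Deletion ks T m) where

      private
        tq mq Vq Wq : ℚ
        tq = ℕ→ℚ (suc t)
        mq = ℕ→ℚ m
        Vq = ℕ→ℚ (𝒦 T (suc l))
        Wq = ℕ→ℚ (𝒦 T (suc (suc l)))

      deficit-bound : (tq - Vq * x) + mq * x ≤ R
      deficit-bound = [ via-rescaling , via-top-level ]′ (deletion-dichotomy pos deleted l)
        where
        via-rescaling : 𝒦 T (suc (suc l)) ℕ.* K′ ℕ.+ m ℕ.* K ℕ.≤ 𝒦 T (suc l) ℕ.* K ℕ.+ m ℕ.* K′ →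
                       (tq - Vq * x) + mq * x ≤ R
        via-rescaling small =
          ≤-trans (rescaled-deficit-≤ tq mq Vq Wq (ℕ→ℚ K′) (ℕ→ℚ K) x y 0≤x 0<K yK≡xK′ slack)
                  (≤-trans (+-monoˡ-≤ (mq * y) (deficit≤γ T (suc l) p′)) (γ-deletion (suc l) p′ deleted))
          where
          slack : Wq * ℕ→ℚ K′ + mq * ℕ→ℚ K ≤ Vq * ℕ→ℚ K + mq * ℕ→ℚ K′
          slack = subst₂ _≤_ (ℕ→ℚ-+-* (𝒦 T (suc (suc l))) K′ m K) (ℕ→ℚ-+-* (𝒦 T (suc l)) K m K′) (ℕ→ℚ-mono-≤ small)
        via-top-level : suc t ℕ.* K′ ℕ.+ m ℕ.* (suc t ℕ.+ m) ℕ.≤ 𝒦 T (suc l) ℕ.* (suc t ℕ.+ m) ℕ.+ m ℕ.* K′ →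
                       (tq - Vq * x) + mq * x ≤ R
        via-top-level large =
          [ (λ ≤half → ≤-trans ≤half (subst (λ n → n * ½ ≤ R) (ℕ→ℚ-deletion-length deleted) (half≤γ ks (suc l) p′)))
          , (λ ≤rest → ≤-trans ≤rest (subst (_≤ R) rest≡ (deficit≤γ ks (suc l) p′))) ]′
          (deficit-≤-half-or-top-deficit tq mq Vq (ℕ→ℚ K′) x 0≤x x≤½
             (ℕ→ℚ-mono-≤ (length≤𝒦 T (deletion-positive deleted pos) l)) (ℕ→ℚ-nonNeg m) slack)
          where
          t+m≡ : ℕ→ℚ (suc t ℕ.+ m) ≡ tq + mq
          t+m≡ = ℕ→ℚ-+ (suc t) m
          slack : tq * ℕ→ℚ K′ + mq * (tq + mq) ≤ Vq * (tq + mq) + mq * ℕ→ℚ K′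
          slack = subst₂ _≤_ (trans (ℕ→ℚ-+-* (suc t) K′ m (suc t ℕ.+ m)) (cong (λ n → tq * ℕ→ℚ K′ + mq * n) t+m≡))
                             (trans (ℕ→ℚ-+-* (𝒦 T (suc l)) (suc t ℕ.+ m) m K′) (cong (λ n → Vq * n + mq * ℕ→ℚ K′) t+m≡))
                             (ℕ→ℚ-mono-≤ large)
          rest≡ : ℕ→ℚ (suc d) - ℕ→ℚ K * y ≡ (tq + mq) - ℕ→ℚ K′ * x
          rest≡ = cong₂ _-_ (ℕ→ℚ-deletion-length deleted) (trans (*-comm (ℕ→ℚ K) y) (trans yK≡xK′ (*-comm x (ℕ→ℚ K′))))

    bound : ∀ {t m} {T : Vec ℕ t} → Deletion ks T m → γ t T (suc l) p + ℕ→ℚ m * x ≤ R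
    bound {zero} {m} deleted = begin
      0ℚ + ℕ→ℚ m * x          ≡⟨ +-identityˡ _ ⟩
      ℕ→ℚ m * x               ≤⟨ *-monoˡ-≤-nonNeg (ℕ→ℚ m) ⦃ nonNegative (ℕ→ℚ-nonNeg m) ⦄ x≤½ ⟩
      ℕ→ℚ m * ½               ≡⟨ cong (λ n → ℕ→ℚ n * ½) (deletion-length deleted) ⟨
      ℕ→ℚ (suc d) * ½         ≤⟨ half≤γ ks (suc l) p′ ⟩
      R                       ∎
      where open ≤-Reasoning
    bound {suc t} {m} {T} deleted = γ-lub T l p
      (≤-trans (half-+-≤ (ℕ→ℚ (suc t)) (ℕ→ℚ m) x x≤½ (ℕ→ℚ-nonNeg m))
               (subst (λ n → n * ½ ≤ R) (ℕ→ℚ-deletion-length deleted) (half≤γ ks (suc l) p′)))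
      (deficit-bound deleted)
      (λ j → subst (_≤ R) (regroup (γ t (removeAt T j) (suc l) p)) (bound (deletion-removeAt deleted j)))
      where
      regroup : ∀ G → G + ℕ→ℚ (suc m) * x ≡ (G + x) + ℕ→ℚ m * x
      regroup G = trans (cong (λ z → G + z) (ℕ→ℚ-suc-* m x)) (sym (+-assoc G x _))

    comparison : γ (suc d) ks (suc l) p ≤ R
    comparison = subst (_≤ R) (trans (cong (λ z → γ (suc d) ks (suc l) p + z) (*-zeroˡ x)) (+-identityʳ _)) (bound none)

open import Defs
open import Data.Nat using (ℕ; _≤_; _<_; _∸_; zero; suc; s≤s)
open import Data.Fin using (Fin)
open import Data.Vec using (Vec; lookup)
open import Data.Rational using (ℚ; _*_) renaming (_≤_ to _≤ℚ_)
open GammaComparison.Comparison using (comparison)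

lemma5p2 : (d : ℕ) → 1 ≤ d → (ks : Vec ℕ d) → (∀ (i : Fin d) → 0 < lookup ks i)
    → (k : ℕ) → 2 ≤ k → (p : ℚ) → ℕ→ℚ 2 ≤ℚ p
    → γ d ks (k ∸ 1) p ≤ℚ γ d ks k (p * ℕ→ℚ (𝒦 ks k) * inv (ℕ→ℚ (𝒦 ks (k ∸ 1))))
lemma5p2 zero    ()
lemma5p2 (suc d) _ ks pos (suc zero)    (s≤s ())
lemma5p2 (suc d) _ ks pos (suc (suc l)) _ p 2≤p = comparison ks pos l p 2≤p
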